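{- Let $d$ be a positive integer and $n\ge 2$ an integer. If the equation $$(x-d)^2+x^2+(x+d)^2=y^n,\qquad x,y\in\mathbb{N},\ \gcd(x,y)=1$$ has a solution, then $n$ is odd, and every solution $(x,y)$ can be expressed as $$x\sqrt{3}+d\sqrt{ -2}=\lambda_1\left(X_1\sqrt{3}+\lambda_2 Y_1\sqrt{ -2}\right)^n,\qquad y=3X_1^2+2Y_1^2,$$ for some $\lambda_1,\lambda_2\in\{1,-1\}$ and some positive integers $X_1,Y_1$ with $\gcd(X_1,Y_1)=1$.
   Context: $\mathbb{N}$ denotes the set of positive integers, and $\sqrt{ -2}=i\sqrt{2}$ in $\mathbb{C}$. -}

module Defs where

open import Data.Nat using (ℕ; zero; suc)
import Data.Nat as ℕ
open import Data.Integer using (ℤ; +_; _+_; _-_; _*_; -_)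
open import Data.Product using (∃-syntax)
open import Relation.Binary.PropositionalEquality using (_≡_)

Odd : ℕ → Set
Odd n = ∃[ k ] n ≡ 1 ℕ.+ 2 ℕ.* k

-- The subring ℤ[√3, √-2] of ℂ, with √-2 = i√2.
-- An element  a + b·√3 + c·√-2 + e·√-6  (where √-6 = √3·√-2 = i√6)
-- is represented by its integer coordinates (a, b, c, e).
-- 1, √3, i√2, i√6 are ℚ-linearly independent in ℂ, so equality of
-- elements of this subring is exactly componentwise equality.
record ℤ√3√-2 : Set where
  constructor ⟨_,_,_,_⟩
  field
    re   : ℤ
    s3   : ℤ
    sm2  : ℤ
    sm6  : ℤ

open ℤ√3√-2 public

one : ℤ√3√-2
one = ⟨ + 1 , + 0 , + 0 , + 0 ⟩

-- Multiplication, using  √3² = 3,  (√-2)² = -2,  (√-6)² = -6,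
-- √3·√-2 = √-6,  √3·√-6 = 3√-2,  √-2·√-6 = -2√3.
infixl 7 _·_
_·_ : ℤ√3√-2 → ℤ√3√-2 → ℤ√3√-2
⟨ a , b , c , e ⟩ · ⟨ a' , b' , c' , e' ⟩ =
  ⟨ a * a' + + 3 * (b * b') - + 2 * (c * c') - + 6 * (e * e')
  , a * b' + b * a' - + 2 * (c * e') - + 2 * (e * c')
  , a * c' + c * a' + + 3 * (b * e') + + 3 * (e * b')
  , a * e' + e * a' + b * c' + c * b'
  ⟩

infixr 8 _^_
_^_ : ℤ√3√-2 → ℕ → ℤ√3√-2
z ^ zero  = one
z ^ suc n = z · (z ^ n)

_√3+_√-2 : ℤ → ℤ → ℤ√3√-2
u √3+ v √-2 = ⟨ + 0 , u , v , + 0 ⟩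

_•_ : ℤ → ℤ√3√-2 → ℤ√3√-2
k • ⟨ a , b , c , e ⟩ = ⟨ k * a , k * b , k * c , k * e ⟩

module Submission where

-- (x − d)² + x² + (x + d)² = 3x² + 2d² is the norm of γ = x√3 + d√-2. The elements a + b√-6
-- and a√3 + b√-2 are closed under multiplication, with multiplicative norms a² + 6b² and
-- 3a² + 2b² (the odd ones account for the non-principal ideal class of ℤ[√-6]), and they factor
-- uniquely: every prime p dividing the norm of a primitive element is itself a norm, by Fermat's
-- descent from s + √-6 with s² ≡ -6 (mod p), and for p ∤ 6 an element π of norm p or its
-- conjugate divides every element whose norm p divides. As gcd(x, y) = 1 makes γ primitive and
-- y prime to 6, peeling off these prime factors gives γ = ±βⁿ with N(β) = y. Powers of even
-- elements are even and those of odd elements are odd exactly in odd degree, so n is odd and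
-- β = ±(X√3 ± Y√-2).

open import Defs
open import Data.Integer using (ℤ; +_; _+_; _-_; _*_; -_; -1ℤ; 1ℤ; 0ℤ; ∣_∣)
import Data.Integer as ℤ
open import Data.Integer.DivMod using (_%_; _/_; a≡a%n+[a/n]*n; n%d<d)
open import Data.Integer.Divisibility.Signed
  using (divides; ∣ᵤ⇒∣; ∣⇒∣ᵤ; ∣m∣n⇒∣m+n; ∣m∣n⇒∣m-n; ∣m+n∣m⇒∣n; ∣m+n∣n⇒∣m; ∣m⇒∣m*n; ∣n⇒∣m*n; ∣-refl; *-cancelˡ-∣)
  renaming (_∣_ to _∣ℤ_; ∣-trans to ∣ℤ-trans)
open import Data.Integer.Properties
  using (pos-*; pos-+; +-injective; abs-*; *-comm; *-assoc; *-identityˡ; *-identityʳ; *-zeroʳ; *-cancelˡ-≡;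
         -1*i≡-i; neg-involutive; ∣i∣≡0⇒i≡0; +∣i∣≡i⊎+∣i∣≡-i)
open import Data.Integer.Tactic.RingSolver using (solve; solve-∀)
open import Data.List using (_∷_; [])
import Data.List.Relation.Unary.All as All
open import Data.Nat using (ℕ; zero; suc; _<_; _≤_; _≥_; z≤n; s≤s)
import Data.Nat as ℕ
open import Data.Nat.Coprimality using (Coprime; coprime-Bézout; coprime⇒gcd≡1)
open import Data.Nat.Divisibility using (_∣_; ∣-trans; ∣1⇒≡1; ∣⇒≤)
import Data.Nat.Divisibility as ℕ
open import Data.Nat.GCD using (gcd; gcd-greatest; module Bézout)
open import Data.Nat.Induction using (<-rec)
open import Data.Nat.ListAction using (product)
open import Data.Nat.Primality using (Prime; euclidsLemma; prime?; prime[2]; prime⇒irreducible; prime⇒nonTrivial; prime⇒nonZero)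
open import Data.Nat.Primality.Factorisation using (factorise)
import Data.Nat.Properties as ℕ
import Data.Nat.Tactic.RingSolver as ℕ-Solver
open import Data.Product using (_×_; _,_; ∃-syntax; proj₁; proj₂)
open import Data.Sum using (_⊎_; inj₁; inj₂)
open import Function using (case_of_)
open import Relation.Binary.PropositionalEquality
open import Relation.Nullary using (¬_; contradiction; yes; no)
open import Relation.Nullary.Decidable using (from-yes; from-no)

-- E a b = a + b√-6 and O a b = a√3 + b√-2.
data H : Set where
  E O : ℤ → ℤ → H

infixl 7 _⊗_
_⊗_ : H → H → H
E a b ⊗ E c d = E (a * c - + 6 * (b * d)) (a * d + b * c)
E a b ⊗ O c d = O (a * c - + 2 * (b * d)) (a * d + + 3 * (b * c))
O a b ⊗ E c d = O (c * a - + 2 * (d * b)) (c * b + + 3 * (d * a))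
O a b ⊗ O c d = E (+ 3 * (a * c) - + 2 * (b * d)) (a * d + b * c)

𝟙 : H
𝟙 = E 1ℤ 0ℤ

conj : H → H
conj (E a b) = E a (- b)
conj (O a b) = O a (- b)

norm : H → ℤ
norm (E a b) = a * a + + 6 * (b * b)
norm (O a b) = + 3 * (a * a) + + 2 * (b * b)

infixr 8 _⊙_
_⊙_ : ℤ → H → H
k ⊙ E a b = E (k * a) (k * b)
k ⊙ O a b = O (k * a) (k * b)

infixr 8 _^ᴴ_
_^ᴴ_ : H → ℕ → H
x ^ᴴ zero  = 𝟙
x ^ᴴ suc n = x ⊗ x ^ᴴ n

coord₁ coord₂ : H → ℤ
coord₁ (E a _) = a
coord₁ (O a _) = a
coord₂ (E _ b) = b
coord₂ (O _ b) = b

⊗-comm : ∀ x y → x ⊗ y ≡ y ⊗ x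
⊗-comm (E a b) (E c d) = cong₂ E (solve (a ∷ b ∷ c ∷ d ∷ [])) (solve (a ∷ b ∷ c ∷ d ∷ []))
⊗-comm (E a b) (O c d) = refl
⊗-comm (O a b) (E c d) = refl
⊗-comm (O a b) (O c d) = cong₂ E (solve (a ∷ b ∷ c ∷ d ∷ [])) (solve (a ∷ b ∷ c ∷ d ∷ []))

⊗-assoc : ∀ x y z → (x ⊗ y) ⊗ z ≡ x ⊗ (y ⊗ z)
⊗-assoc (E a b) (E c d) (E e f) = cong₂ E (solve (a ∷ b ∷ c ∷ d ∷ e ∷ f ∷ [])) (solve (a ∷ b ∷ c ∷ d ∷ e ∷ f ∷ []))
⊗-assoc (E a b) (E c d) (O e f) = cong₂ O (solve (a ∷ b ∷ c ∷ d ∷ e ∷ f ∷ [])) (solve (a ∷ b ∷ c ∷ d ∷ e ∷ f ∷ []))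
⊗-assoc (E a b) (O c d) (E e f) = cong₂ O (solve (a ∷ b ∷ c ∷ d ∷ e ∷ f ∷ [])) (solve (a ∷ b ∷ c ∷ d ∷ e ∷ f ∷ []))
⊗-assoc (E a b) (O c d) (O e f) = cong₂ E (solve (a ∷ b ∷ c ∷ d ∷ e ∷ f ∷ [])) (solve (a ∷ b ∷ c ∷ d ∷ e ∷ f ∷ []))
⊗-assoc (O a b) (E c d) (E e f) = cong₂ O (solve (a ∷ b ∷ c ∷ d ∷ e ∷ f ∷ [])) (solve (a ∷ b ∷ c ∷ d ∷ e ∷ f ∷ []))
⊗-assoc (O a b) (E c d) (O e f) = cong₂ E (solve (a ∷ b ∷ c ∷ d ∷ e ∷ f ∷ [])) (solve (a ∷ b ∷ c ∷ d ∷ e ∷ f ∷ []))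
⊗-assoc (O a b) (O c d) (E e f) = cong₂ E (solve (a ∷ b ∷ c ∷ d ∷ e ∷ f ∷ [])) (solve (a ∷ b ∷ c ∷ d ∷ e ∷ f ∷ []))
⊗-assoc (O a b) (O c d) (O e f) = cong₂ O (solve (a ∷ b ∷ c ∷ d ∷ e ∷ f ∷ [])) (solve (a ∷ b ∷ c ∷ d ∷ e ∷ f ∷ []))

⊗-identityˡ : ∀ x → 𝟙 ⊗ x ≡ x
⊗-identityˡ (E a b) = cong₂ E (solve (a ∷ b ∷ [])) (solve (a ∷ b ∷ []))
⊗-identityˡ (O a b) = cong₂ O (solve (a ∷ b ∷ [])) (solve (a ∷ b ∷ []))

⊗-identityʳ : ∀ x → x ⊗ 𝟙 ≡ x
⊗-identityʳ x = trans (⊗-comm x 𝟙) (⊗-identityˡ x)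

conj-involutive : ∀ x → conj (conj x) ≡ x
conj-involutive (E a b) = cong (E a) (solve (b ∷ []))
conj-involutive (O a b) = cong (O a) (solve (b ∷ []))

norm-⊗ : ∀ x y → norm (x ⊗ y) ≡ norm x * norm y
norm-⊗ (E a b) (E c d) = identity a b c d
  where identity : ∀ a b c d → (a * c - + 6 * (b * d)) * (a * c - + 6 * (b * d)) + + 6 * ((a * d + b * c) * (a * d + b * c)) ≡ (a * a + + 6 * (b * b)) * (c * c + + 6 * (d * d))
        identity = solve-∀
norm-⊗ (E a b) (O c d) = identity a b c d
  where identity : ∀ a b c d → + 3 * ((a * c - + 2 * (b * d)) * (a * c - + 2 * (b * d))) + + 2 * ((a * d + + 3 * (b * c)) * (a * d + + 3 * (b * c))) ≡ (a * a + + 6 * (b * b)) * (+ 3 * (c * c) + + 2 * (d * d))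
        identity = solve-∀
norm-⊗ (O a b) (E c d) = identity a b c d
  where identity : ∀ a b c d → + 3 * ((c * a - + 2 * (d * b)) * (c * a - + 2 * (d * b))) + + 2 * ((c * b + + 3 * (d * a)) * (c * b + + 3 * (d * a))) ≡ (+ 3 * (a * a) + + 2 * (b * b)) * (c * c + + 6 * (d * d))
        identity = solve-∀
norm-⊗ (O a b) (O c d) = identity a b c d
  where identity : ∀ a b c d → (+ 3 * (a * c) - + 2 * (b * d)) * (+ 3 * (a * c) - + 2 * (b * d)) + + 6 * ((a * d + b * c) * (a * d + b * c)) ≡ (+ 3 * (a * a) + + 2 * (b * b)) * (+ 3 * (c * c) + + 2 * (d * d))
        identity = solve-∀

norm-conj : ∀ x → norm (conj x) ≡ norm x
norm-conj (E a b) = cong (λ t → a * a + + 6 * t) (neg-square b)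
  where neg-square : ∀ b → (- b) * (- b) ≡ b * b
        neg-square = solve-∀
norm-conj (O a b) = cong (λ t → + 3 * (a * a) + + 2 * t) (neg-square b)
  where neg-square : ∀ b → (- b) * (- b) ≡ b * b
        neg-square = solve-∀

⊗-conj : ∀ x → x ⊗ conj x ≡ norm x ⊙ 𝟙
⊗-conj (E a b) = cong₂ E (real a b) (imaginary a b)
  where real : ∀ a b → a * a - + 6 * (b * (- b)) ≡ (a * a + + 6 * (b * b)) * 1ℤ
        real = solve-∀
        imaginary : ∀ a b → a * (- b) + b * a ≡ (a * a + + 6 * (b * b)) * 0ℤ
        imaginary = solve-∀
⊗-conj (O a b) = cong₂ E (real a b) (imaginary a b)
  where real : ∀ a b → + 3 * (a * a) - + 2 * (b * (- b)) ≡ (+ 3 * (a * a) + + 2 * (b * b)) * 1ℤ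
        real = solve-∀
        imaginary : ∀ a b → a * (- b) + b * a ≡ (+ 3 * (a * a) + + 2 * (b * b)) * 0ℤ
        imaginary = solve-∀

⊙-⊗ˡ : ∀ k x y → (k ⊙ x) ⊗ y ≡ k ⊙ (x ⊗ y)
⊙-⊗ˡ k (E a b) (E c d) = cong₂ E (solve (k ∷ a ∷ b ∷ c ∷ d ∷ [])) (solve (k ∷ a ∷ b ∷ c ∷ d ∷ []))
⊙-⊗ˡ k (E a b) (O c d) = cong₂ O (solve (k ∷ a ∷ b ∷ c ∷ d ∷ [])) (solve (k ∷ a ∷ b ∷ c ∷ d ∷ []))
⊙-⊗ˡ k (O a b) (E c d) = cong₂ O (solve (k ∷ a ∷ b ∷ c ∷ d ∷ [])) (solve (k ∷ a ∷ b ∷ c ∷ d ∷ []))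
⊙-⊗ˡ k (O a b) (O c d) = cong₂ E (solve (k ∷ a ∷ b ∷ c ∷ d ∷ [])) (solve (k ∷ a ∷ b ∷ c ∷ d ∷ []))

⊙-⊗ʳ : ∀ k x y → x ⊗ (k ⊙ y) ≡ k ⊙ (x ⊗ y)
⊙-⊗ʳ k x y = trans (⊗-comm x (k ⊙ y)) (trans (⊙-⊗ˡ k y x) (cong (k ⊙_) (⊗-comm y x)))

⊙-𝟙-⊗ : ∀ k x → (k ⊙ 𝟙) ⊗ x ≡ k ⊙ x
⊙-𝟙-⊗ k x = trans (⊙-⊗ˡ k 𝟙 x) (cong (k ⊙_) (⊗-identityˡ x))

⊙-⊙ : ∀ k l x → k ⊙ (l ⊙ x) ≡ (k * l) ⊙ x
⊙-⊙ k l (E a b) = cong₂ E (solve (k ∷ l ∷ a ∷ [])) (solve (k ∷ l ∷ b ∷ []))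
⊙-⊙ k l (O a b) = cong₂ O (solve (k ∷ l ∷ a ∷ [])) (solve (k ∷ l ∷ b ∷ []))

⊙-identity : ∀ x → 1ℤ ⊙ x ≡ x
⊙-identity (E a b) = cong₂ E (solve (a ∷ [])) (solve (b ∷ []))
⊙-identity (O a b) = cong₂ O (solve (a ∷ [])) (solve (b ∷ []))

⊙-cancel : ∀ k .{{_ : ℤ.NonZero k}} {x y} → k ⊙ x ≡ k ⊙ y → x ≡ y
⊙-cancel k {E a b} {E c d} eq = cong₂ E (*-cancelˡ-≡ k a c (cong coord₁ eq)) (*-cancelˡ-≡ k b d (cong coord₂ eq))
⊙-cancel k {O a b} {O c d} eq = cong₂ O (*-cancelˡ-≡ k a c (cong coord₁ eq)) (*-cancelˡ-≡ k b d (cong coord₂ eq))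
⊙-cancel k {E a b} {O c d} ()
⊙-cancel k {O a b} {E c d} ()

⊗-conj-⊗ : ∀ π δ → π ⊗ (conj π ⊗ δ) ≡ norm π ⊙ δ
⊗-conj-⊗ π δ = begin
  π ⊗ (conj π ⊗ δ)  ≡⟨ sym (⊗-assoc π (conj π) δ) ⟩
  (π ⊗ conj π) ⊗ δ  ≡⟨ cong (_⊗ δ) (⊗-conj π) ⟩
  (norm π ⊙ 𝟙) ⊗ δ  ≡⟨ ⊙-𝟙-⊗ (norm π) δ ⟩
  norm π ⊙ δ        ∎
  where open ≡-Reasoning

norm-cofactor : ∀ {a b} α {γ} δ .{{_ : ℕ.NonZero a}} → γ ≡ α ⊗ δ →
                norm α ≡ + a → norm γ ≡ + (a ℕ.* b) → norm δ ≡ + b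
norm-cofactor {a} {b} α {γ} δ γ≡αδ Nα Nγ = *-cancelˡ-≡ (+ a) (norm δ) (+ b) (begin
  + a * norm δ      ≡⟨ cong (_* norm δ) Nα ⟨
  norm α * norm δ   ≡⟨ norm-⊗ α δ ⟨
  norm (α ⊗ δ)      ≡⟨ cong norm γ≡αδ ⟨
  norm γ            ≡⟨ Nγ ⟩
  + (a ℕ.* b)       ≡⟨ pos-* a b ⟩
  + a * + b         ∎)
  where open ≡-Reasoning

𝟙-^ᴴ : ∀ n → 𝟙 ^ᴴ n ≡ 𝟙
𝟙-^ᴴ zero    = refl
𝟙-^ᴴ (suc n) = trans (cong (𝟙 ⊗_) (𝟙-^ᴴ n)) (⊗-identityˡ 𝟙)

^ᴴ-distrib-⊗ : ∀ x y n → (x ⊗ y) ^ᴴ n ≡ x ^ᴴ n ⊗ y ^ᴴ n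
^ᴴ-distrib-⊗ x y zero    = sym (⊗-identityˡ 𝟙)
^ᴴ-distrib-⊗ x y (suc n) = begin
  (x ⊗ y) ⊗ (x ⊗ y) ^ᴴ n          ≡⟨ cong ((x ⊗ y) ⊗_) (^ᴴ-distrib-⊗ x y n) ⟩
  (x ⊗ y) ⊗ (x ^ᴴ n ⊗ y ^ᴴ n)     ≡⟨ ⊗-assoc x y _ ⟩
  x ⊗ (y ⊗ (x ^ᴴ n ⊗ y ^ᴴ n))     ≡⟨ cong (x ⊗_) (⊗-assoc y _ _) ⟨
  x ⊗ ((y ⊗ x ^ᴴ n) ⊗ y ^ᴴ n)     ≡⟨ cong (λ t → x ⊗ (t ⊗ y ^ᴴ n)) (⊗-comm y _) ⟩
  x ⊗ ((x ^ᴴ n ⊗ y) ⊗ y ^ᴴ n)     ≡⟨ cong (x ⊗_) (⊗-assoc _ y _) ⟩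
  x ⊗ (x ^ᴴ n ⊗ (y ⊗ y ^ᴴ n))     ≡⟨ ⊗-assoc x _ _ ⟨
  (x ⊗ x ^ᴴ n) ⊗ (y ⊗ y ^ᴴ n)     ∎
  where open ≡-Reasoning

^ᴴ-⊙ : ∀ k x n → (k ⊙ x) ^ᴴ n ≡ (k ℤ.^ n) ⊙ x ^ᴴ n
^ᴴ-⊙ k x zero    = sym (⊙-identity 𝟙)
^ᴴ-⊙ k x (suc n) = begin
  (k ⊙ x) ⊗ (k ⊙ x) ^ᴴ n           ≡⟨ cong ((k ⊙ x) ⊗_) (^ᴴ-⊙ k x n) ⟩
  (k ⊙ x) ⊗ (k ℤ.^ n) ⊙ x ^ᴴ n     ≡⟨ ⊙-⊗ˡ k x _ ⟩
  k ⊙ (x ⊗ (k ℤ.^ n) ⊙ x ^ᴴ n)     ≡⟨ cong (k ⊙_) (⊙-⊗ʳ (k ℤ.^ n) x (x ^ᴴ n)) ⟩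
  k ⊙ (k ℤ.^ n) ⊙ (x ⊗ x ^ᴴ n)     ≡⟨ ⊙-⊙ k (k ℤ.^ n) _ ⟩
  (k * k ℤ.^ n) ⊙ (x ⊗ x ^ᴴ n)     ∎
  where open ≡-Reasoning

-- Divisibility by rational primes

prime>1 : ∀ {p} → Prime p → 1 < p
prime>1 {p} pp = ℕ.nonTrivial⇒n>1 p {{prime⇒nonTrivial pp}}

prime[3] : Prime 3
prime[3] = from-yes (prime? 3)

2∤3 : ¬ (2 ∣ 3)
2∤3 = from-no (2 ℕ.∣? 3)

3∤2 : ¬ (3 ∣ 2)
3∤2 = from-no (3 ℕ.∣? 2)

2∣6 : 2 ∣ 6
2∣6 = ℕ.divides 3 refl

3∣6 : 3 ∣ 6
3∣6 = ℕ.divides 2 refl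

∤-∣6 : ∀ {p k} → k ∣ 6 → ¬ (p ∣ 6) → ¬ (p ∣ k)
∤-∣6 k∣6 p∤6 p∣k = p∤6 (∣-trans p∣k k∣6)

prime∣prime⇒≡ : ∀ {p q} → Prime p → Prime q → p ∣ q → p ≡ q
prime∣prime⇒≡ pp pq p∣q with prime⇒irreducible pq p∣q
... | inj₁ refl = contradiction refl (ℕ.<⇒≢ (prime>1 pp))
... | inj₂ p≡q = p≡q

prime∤6 : ∀ {p} → Prime p → p ≢ 2 → p ≢ 3 → ¬ (p ∣ 6)
prime∤6 pp p≢2 p≢3 p∣6 with euclidsLemma 2 3 pp p∣6
... | inj₁ p∣2 = p≢2 (prime∣prime⇒≡ pp prime[2] p∣2)
... | inj₂ p∣3 = p≢3 (prime∣prime⇒≡ pp prime[3] p∣3)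

∃prime∣ : ∀ m → 1 < m → ∃[ q ] (Prime q × q ∣ m)
∃prime∣ m@(suc _) 1<m with factorise m
... | record { factors = [] ; isFactorisation = m≡1 } = contradiction (sym m≡1) (ℕ.<⇒≢ 1<m)
... | record { factors = q ∷ qs ; isFactorisation = m≡q*qs ; factorsPrime = pq All.∷ _ } =
  q , pq , ℕ.divides (product qs) (trans m≡q*qs (ℕ.*-comm q (product qs)))

prime∣^⇒∣ : ∀ {q} y n → Prime q → q ∣ y ℕ.^ n → q ∣ y
prime∣^⇒∣ y zero    pq q∣1 = contradiction (sym (∣1⇒≡1 q∣1)) (ℕ.<⇒≢ (prime>1 pq))
prime∣^⇒∣ y (suc n) pq q∣yyⁿ with euclidsLemma y (y ℕ.^ n) pq q∣yyⁿ
... | inj₁ q∣y  = q∣y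
... | inj₂ q∣yⁿ = prime∣^⇒∣ y n pq q∣yⁿ

euclidsLemmaℤ : ∀ {p} x y → Prime p → + p ∣ℤ x * y → + p ∣ℤ x ⊎ + p ∣ℤ y
euclidsLemmaℤ x y pp p∣xy with euclidsLemma ∣ x ∣ ∣ y ∣ pp (subst (_ ∣_) (abs-* x y) (∣⇒∣ᵤ p∣xy))
... | inj₁ p∣x = inj₁ (∣ᵤ⇒∣ p∣x)
... | inj₂ p∣y = inj₂ (∣ᵤ⇒∣ p∣y)

prime∣square⇒∣ : ∀ {p} x → Prime p → + p ∣ℤ x * x → + p ∣ℤ x
prime∣square⇒∣ x pp p∣xx with euclidsLemmaℤ x x pp p∣xx
... | inj₁ p∣x = p∣x
... | inj₂ p∣x = p∣x

prime∣*-cancelˡ : ∀ {p} k x → Prime p → ¬ (p ∣ ∣ k ∣) → + p ∣ℤ k * x → + p ∣ℤ x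
prime∣*-cancelˡ k x pp p∤k p∣kx with euclidsLemmaℤ k x pp p∣kx
... | inj₁ p∣k = contradiction (∣⇒∣ᵤ p∣k) p∤k
... | inj₂ p∣x = p∣x

infix 4 _∣ᶜ_ _∣ᴴ_

_∣ᶜ_ : ℤ → H → Set
k ∣ᶜ x = k ∣ℤ coord₁ x × k ∣ℤ coord₂ x

_∣ᴴ_ : H → H → Set
α ∣ᴴ γ = ∃[ δ ] γ ≡ α ⊗ δ

Primitive : H → Set
Primitive γ = ∀ {q} → Prime q → ¬ (+ q ∣ᶜ γ)

∣ᶜ⇒⊙ : ∀ {k} x → k ∣ᶜ x → ∃[ δ ] x ≡ k ⊙ δ
∣ᶜ⇒⊙ {k} (E a b) (divides qa ea , divides qb eb) = E qa qb , cong₂ E (trans ea (*-comm qa k)) (trans eb (*-comm qb k))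
∣ᶜ⇒⊙ {k} (O a b) (divides qa ea , divides qb eb) = O qa qb , cong₂ O (trans ea (*-comm qa k)) (trans eb (*-comm qb k))

∣ᶜ-⊙ : ∀ k δ → k ∣ᶜ k ⊙ δ
∣ᶜ-⊙ k (E a b) = divides a (*-comm k a) , divides b (*-comm k b)
∣ᶜ-⊙ k (O a b) = divides a (*-comm k a) , divides b (*-comm k b)

∣-∣ᶜ-trans : ∀ {k l} x → k ∣ℤ l → l ∣ᶜ x → k ∣ᶜ x
∣-∣ᶜ-trans x k∣l (l∣c₁ , l∣c₂) = ∣ℤ-trans k∣l l∣c₁ , ∣ℤ-trans k∣l l∣c₂

∣ᶜ-⊗ : ∀ {k} α δ → k ∣ᶜ δ → k ∣ᶜ α ⊗ δ
∣ᶜ-⊗ {k} α δ k∣δ with ∣ᶜ⇒⊙ δ k∣δ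
... | δ′ , refl = subst (k ∣ᶜ_) (sym (⊙-⊗ʳ k α δ′)) (∣ᶜ-⊙ k (α ⊗ δ′))

∣ᶜ-⊙ʳ : ∀ {k} s x → k ∣ᶜ x → k ∣ᶜ s ⊙ x
∣ᶜ-⊙ʳ s x k∣x = subst (_ ∣ᶜ_) (⊙-𝟙-⊗ s x) (∣ᶜ-⊗ (s ⊙ 𝟙) x k∣x)

∣ᶜ-^ᴴ : ∀ {k} x n → k ∣ᶜ x → k ∣ᶜ x ^ᴴ suc n
∣ᶜ-^ᴴ x n k∣x = subst (_ ∣ᶜ_) (⊗-comm (x ^ᴴ n) x) (∣ᶜ-⊗ (x ^ᴴ n) x k∣x)

∣ᶜ⇒∣norm : ∀ {k} x → k ∣ᶜ x → k ∣ℤ norm x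
∣ᶜ⇒∣norm (E a b) (k∣a , k∣b) = ∣m∣n⇒∣m+n (∣m⇒∣m*n a k∣a) (∣n⇒∣m*n (+ 6) (∣m⇒∣m*n b k∣b))
∣ᶜ⇒∣norm (O a b) (k∣a , k∣b) = ∣m∣n⇒∣m+n (∣n⇒∣m*n (+ 3) (∣m⇒∣m*n a k∣a)) (∣n⇒∣m*n (+ 2) (∣m⇒∣m*n b k∣b))

primitive-cofactor : ∀ α δ → Primitive (α ⊗ δ) → Primitive δ
primitive-cofactor α δ prim pq q∣δ = prim pq (∣ᶜ-⊗ α δ q∣δ)

primitive-base : ∀ s β n → Primitive (s ⊙ β ^ᴴ suc n) → Primitive β
primitive-base s β n prim pq q∣β = prim pq (∣ᶜ-⊙ʳ s (β ^ᴴ suc n) (∣ᶜ-^ᴴ β n q∣β))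

primitive-coprime : ∀ x → Primitive x → 1 ≤ ∣ coord₁ x ∣ → gcd ∣ coord₁ x ∣ ∣ coord₂ x ∣ ≡ 1
primitive-coprime x prim 1≤c₁ = coprime⇒gcd≡1 coprime
  where
  coprime : Coprime ∣ coord₁ x ∣ ∣ coord₂ x ∣
  coprime {zero}        (0∣c₁ , _) = contradiction (ℕ.0∣⇒≡0 0∣c₁) (ℕ.n>0⇒n≢0 1≤c₁)
  coprime {1}           _          = refl
  coprime {suc (suc i)} (i∣c₁ , i∣c₂) with q , pq , q∣i ← ∃prime∣ (suc (suc i)) (s≤s (s≤s z≤n)) =
    contradiction (∣ᵤ⇒∣ (∣-trans q∣i i∣c₁) , ∣ᵤ⇒∣ (∣-trans q∣i i∣c₂)) (prim pq)

∣norm∧∣coord₁⇒∣ᶜ : ∀ {p} w → Prime p → ¬ (p ∣ 6) → + p ∣ℤ norm w → + p ∣ℤ coord₁ w → + p ∣ᶜ w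
∣norm∧∣coord₁⇒∣ᶜ (E a b) pp p∤6 p∣N p∣a =
  p∣a , prime∣square⇒∣ b pp (prime∣*-cancelˡ (+ 6) (b * b) pp p∤6 (∣m+n∣m⇒∣n p∣N (∣m⇒∣m*n a p∣a)))
∣norm∧∣coord₁⇒∣ᶜ (O a b) pp p∤6 p∣N p∣a =
  p∣a , prime∣square⇒∣ b pp (prime∣*-cancelˡ (+ 2) (b * b) pp (∤-∣6 2∣6 p∤6) (∣m+n∣m⇒∣n p∣N (∣n⇒∣m*n (+ 3) (∣m⇒∣m*n a p∣a))))

∣norm∧∣coord₂⇒∣ᶜ : ∀ {p} w → Prime p → ¬ (p ∣ 6) → + p ∣ℤ norm w → + p ∣ℤ coord₂ w → + p ∣ᶜ w
∣norm∧∣coord₂⇒∣ᶜ (E a b) pp p∤6 p∣N p∣b =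
  prime∣square⇒∣ a pp (∣m+n∣n⇒∣m p∣N (∣n⇒∣m*n (+ 6) (∣m⇒∣m*n b p∣b))) , p∣b
∣norm∧∣coord₂⇒∣ᶜ (O a b) pp p∤6 p∣N p∣b =
  prime∣square⇒∣ a pp (prime∣*-cancelˡ (+ 3) (a * a) pp (∤-∣6 3∣6 p∤6) (∣m+n∣n⇒∣m p∣N (∣n⇒∣m*n (+ 2) (∣m⇒∣m*n b p∣b)))) , p∣b

coord₁-product-combination : ∀ π δ → ∃[ k ] ∃[ A ] ∃[ B ]
  (∣ k ∣ ∣ 3 × k * (coord₁ (conj π ⊗ δ) * coord₁ (π ⊗ δ)) ≡ A * norm δ - B * norm π)
coord₁-product-combination (E a b) (E c d) = + 1 , a * a , + 6 * (d * d) , ℕ.divides 3 refl , identity a b c d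
  where identity : ∀ a b c d → + 1 * ((a * c - + 6 * ((- b) * d)) * (a * c - + 6 * (b * d))) ≡ a * a * (c * c + + 6 * (d * d)) - + 6 * (d * d) * (a * a + + 6 * (b * b))
        identity = solve-∀
coord₁-product-combination (E a b) (O c d) = + 3 , a * a , + 2 * (d * d) , ℕ.divides 1 refl , identity a b c d
  where identity : ∀ a b c d → + 3 * ((a * c - + 2 * ((- b) * d)) * (a * c - + 2 * (b * d))) ≡ a * a * (+ 3 * (c * c) + + 2 * (d * d)) - + 2 * (d * d) * (a * a + + 6 * (b * b))
        identity = solve-∀
coord₁-product-combination (O a b) (E c d) = + 3 , - (+ 2 * (b * b)) , - (c * c) , ℕ.divides 1 refl , identity a b c d
  where identity : ∀ a b c d → + 3 * ((c * a - + 2 * (d * (- b))) * (c * a - + 2 * (d * b))) ≡ - (+ 2 * (b * b)) * (c * c + + 6 * (d * d)) - - (c * c) * (+ 3 * (a * a) + + 2 * (b * b))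
        identity = solve-∀
coord₁-product-combination (O a b) (O c d) = + 1 , + 3 * (a * a) , + 2 * (d * d) , ℕ.divides 3 refl , identity a b c d
  where identity : ∀ a b c d → + 1 * ((+ 3 * (a * c) - + 2 * ((- b) * d)) * (+ 3 * (a * c) - + 2 * (b * d))) ≡ + 3 * (a * a) * (+ 3 * (c * c) + + 2 * (d * d)) - + 2 * (d * d) * (+ 3 * (a * a) + + 2 * (b * b))
        identity = solve-∀

∣coord₁-⊗⇒conj-∣ᴴ : ∀ {p} π δ → Prime p → ¬ (p ∣ 6) → norm π ≡ + p → + p ∣ℤ coord₁ (π ⊗ δ) → conj π ∣ᴴ δ
∣coord₁-⊗⇒conj-∣ᴴ {p} π δ pp p∤6 Nπ p∣c₁ = δ′ , ⊙-cancel (+ p) {{prime⇒nonZero pp}} (sym (begin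
  (+ p) ⊙ (conj π ⊗ δ′)         ≡⟨ ⊙-⊗ʳ (+ p) (conj π) δ′ ⟨
  conj π ⊗ (+ p) ⊙ δ′           ≡⟨ cong (conj π ⊗_) πδ≡pδ′ ⟨
  conj π ⊗ (π ⊗ δ)              ≡⟨ cong (λ σ → conj π ⊗ (σ ⊗ δ)) (conj-involutive π) ⟨
  conj π ⊗ (conj (conj π) ⊗ δ)  ≡⟨ ⊗-conj-⊗ (conj π) δ ⟩
  norm (conj π) ⊙ δ             ≡⟨ cong (_⊙ δ) (trans (norm-conj π) Nπ) ⟩
  (+ p) ⊙ δ                     ∎))
  where
  open ≡-Reasoning
  p∣N : + p ∣ℤ norm (π ⊗ δ)
  p∣N = subst (+ p ∣ℤ_) (sym (trans (norm-⊗ π δ) (cong (_* norm δ) Nπ))) (∣m⇒∣m*n (norm δ) ∣-refl)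
  p∣πδ = ∣ᶜ⇒⊙ (π ⊗ δ) (∣norm∧∣coord₁⇒∣ᶜ (π ⊗ δ) pp p∤6 p∣N p∣c₁)
  δ′ = proj₁ p∣πδ
  πδ≡pδ′ = proj₂ p∣πδ

-- Euclid's lemma in the rational coordinate: p divides c₁(π̄δ)·c₁(πδ), hence one factor,
-- and then all of π̄δ or πδ, since π π̄ = p.
prime-norm-∣ᴴ : ∀ {p} π δ → Prime p → ¬ (p ∣ 6) → norm π ≡ + p → + p ∣ℤ norm δ → π ∣ᴴ δ ⊎ conj π ∣ᴴ δ
prime-norm-∣ᴴ {p} π δ pp p∤6 Nπ p∣Nδ
  with k , A , B , k∣3 , eq ← coord₁-product-combination π δ
  with euclidsLemmaℤ _ _ pp (prime∣*-cancelˡ k _ pp (∤-∣6 (∣-trans k∣3 3∣6) p∤6)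
         (subst (+ p ∣ℤ_) (sym eq) (∣m∣n⇒∣m-n (∣n⇒∣m*n A p∣Nδ) (∣n⇒∣m*n B (subst (+ p ∣ℤ_) (sym Nπ) ∣-refl)))))
... | inj₁ p∣c₁π̄δ = inj₁ (subst (_∣ᴴ δ) (conj-involutive π)
                      (∣coord₁-⊗⇒conj-∣ᴴ (conj π) δ pp p∤6 (trans (norm-conj π) Nπ) p∣c₁π̄δ))
... | inj₂ p∣c₁πδ = inj₂ (∣coord₁-⊗⇒conj-∣ᴴ π δ pp p∤6 Nπ p∣c₁πδ)

√-2 √3 : H
√-2 = O 0ℤ 1ℤ
√3  = O 1ℤ 0ℤ

2∣norm⇒√-2∣ᴴ : ∀ δ → + 2 ∣ℤ norm δ → √-2 ∣ᴴ δ
2∣norm⇒√-2∣ᴴ (E a b) 2∣N with prime∣square⇒∣ a prime[2] (∣m+n∣n⇒∣m 2∣N (∣m⇒∣m*n (b * b) (divides (+ 3) refl)))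
... | divides k refl = O b (- k) , cong₂ E (identity₁ k b) (identity₂ k b)
  where identity₁ : ∀ k b → k * + 2 ≡ + 3 * (0ℤ * b) - + 2 * (1ℤ * (- k))
        identity₁ = solve-∀
        identity₂ : ∀ k b → b ≡ 0ℤ * (- k) + 1ℤ * b
        identity₂ = solve-∀
2∣norm⇒√-2∣ᴴ (O a b) 2∣N
  with prime∣square⇒∣ a prime[2] (prime∣*-cancelˡ (+ 3) (a * a) prime[2] 2∤3 (∣m+n∣n⇒∣m 2∣N (∣m⇒∣m*n (b * b) ∣-refl)))
... | divides k refl = E b (- k) , cong₂ O (identity₁ k b) (identity₂ k b)
  where identity₁ : ∀ k b → k * + 2 ≡ b * 0ℤ - + 2 * ((- k) * 1ℤ)
        identity₁ = solve-∀
        identity₂ : ∀ k b → b ≡ b * 1ℤ + + 3 * ((- k) * 0ℤ)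
        identity₂ = solve-∀

3∣norm⇒√3∣ᴴ : ∀ δ → + 3 ∣ℤ norm δ → √3 ∣ᴴ δ
3∣norm⇒√3∣ᴴ (E a b) 3∣N with prime∣square⇒∣ a prime[3] (∣m+n∣n⇒∣m 3∣N (∣m⇒∣m*n (b * b) (divides (+ 2) refl)))
... | divides k refl = O k b , cong₂ E (identity₁ k b) (identity₂ k b)
  where identity₁ : ∀ k b → k * + 3 ≡ + 3 * (1ℤ * k) - + 2 * (0ℤ * b)
        identity₁ = solve-∀
        identity₂ : ∀ k b → b ≡ 1ℤ * b + 0ℤ * k
        identity₂ = solve-∀
3∣norm⇒√3∣ᴴ (O a b) 3∣N =
  √3∣ᴴ a b (prime∣square⇒∣ b prime[3] (prime∣*-cancelˡ (+ 2) (b * b) prime[3] 3∤2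
    (∣m+n∣m⇒∣n {+ 3} {+ 3 * (a * a)} {+ 2 * (b * b)} 3∣N (∣m⇒∣m*n {+ 3} {+ 3} (a * a) ∣-refl))))
  where
  √3∣ᴴ : ∀ a b → + 3 ∣ℤ b → √3 ∣ᴴ O a b
  √3∣ᴴ a b (divides k refl) = E a k , cong₂ O (identity₁ k a) (identity₂ k a)
    where identity₁ : ∀ k a → a ≡ a * 1ℤ - + 2 * (k * 0ℤ)
          identity₁ = solve-∀
          identity₂ : ∀ k a → k * + 3 ≡ a * 0ℤ + + 3 * (k * 1ℤ)
          identity₂ = solve-∀

-- ρ² is an associate of q, so q² ∣ N(γ) makes q divide γ.
ramified-square-∤ : ∀ {q} ρ c → Prime q → norm ρ ≡ + q → ρ ⊗ ρ ≡ c ⊙ 𝟙 → + q ∣ℤ c →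
                    (∀ δ → + q ∣ℤ norm δ → ρ ∣ᴴ δ) → ∀ γ → Primitive γ → ¬ (+ q * + q ∣ℤ norm γ)
ramified-square-∤ {q} ρ c pq Nρ ρρ≡c q∣c ρ-∣ᴴ γ prim q²∣Nγ = prim pq (∣-∣ᶜ-trans γ q∣c (subst (c ∣ᶜ_) (sym γ≡cδ′) (∣ᶜ-⊙ c δ′)))
  where
  open ≡-Reasoning
  ρ∣γ = ρ-∣ᴴ γ (∣ℤ-trans (∣m⇒∣m*n (+ q) ∣-refl) q²∣Nγ)
  δ = proj₁ ρ∣γ
  q∣Nδ : + q ∣ℤ norm δ
  q∣Nδ = *-cancelˡ-∣ (+ q) {{prime⇒nonZero pq}}
    (subst (+ q * + q ∣ℤ_) (trans (cong norm (proj₂ ρ∣γ)) (trans (norm-⊗ ρ δ) (cong (_* norm δ) Nρ))) q²∣Nγ)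
  ρ∣δ = ρ-∣ᴴ δ q∣Nδ
  δ′ = proj₁ ρ∣δ
  γ≡cδ′ : γ ≡ c ⊙ δ′
  γ≡cδ′ = begin
    γ                 ≡⟨ proj₂ ρ∣γ ⟩
    ρ ⊗ δ             ≡⟨ cong (ρ ⊗_) (proj₂ ρ∣δ) ⟩
    ρ ⊗ (ρ ⊗ δ′)      ≡⟨ ⊗-assoc ρ ρ δ′ ⟨
    (ρ ⊗ ρ) ⊗ δ′      ≡⟨ cong (_⊗ δ′) ρρ≡c ⟩
    (c ⊙ 𝟙) ⊗ δ′      ≡⟨ ⊙-𝟙-⊗ c δ′ ⟩
    c ⊙ δ′            ∎

primitive⇒4∤norm : ∀ γ → Primitive γ → ¬ (+ 2 * + 2 ∣ℤ norm γ)
primitive⇒4∤norm = ramified-square-∤ √-2 (- + 2) prime[2] refl refl (divides -1ℤ refl) 2∣norm⇒√-2∣ᴴ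

primitive⇒9∤norm : ∀ γ → Primitive γ → ¬ (+ 3 * + 3 ∣ℤ norm γ)
primitive⇒9∤norm = ramified-square-∤ √3 (+ 3) prime[3] refl refl ∣-refl 3∣norm⇒√3∣ᴴ

-- Primes as norms

inverse-mod-primeℕ : ∀ {p} n → Prime p → ¬ (p ∣ n) → ∃[ w ] (+ p ∣ℤ w * + n - 1ℤ)
inverse-mod-primeℕ {p} n pp p∤n with coprime-Bézout coprime
  where
  coprime : Coprime n p
  coprime (d∣n , d∣p) with prime⇒irreducible pp d∣p
  ... | inj₁ d≡1 = d≡1
  ... | inj₂ refl = contradiction d∣n p∤n
... | Bézout.+- x y 1+yp≡xn = + x , divides (+ y) (begin
  + x * + n - 1ℤ          ≡⟨ cong (_- 1ℤ) (trans (cong +_ 1+yp≡xn) (pos-* x n)) ⟨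
  + (1 ℕ.+ y ℕ.* p) - 1ℤ  ≡⟨ cong (λ t → 1ℤ + t - 1ℤ) (pos-* y p) ⟩
  1ℤ + + y * + p - 1ℤ     ≡⟨ identity (+ y * + p) ⟩
  + y * + p               ∎)
  where open ≡-Reasoning
        identity : ∀ u → 1ℤ + u - 1ℤ ≡ u
        identity = solve-∀
... | Bézout.-+ x y 1+xn≡yp = - + x , divides (- + y) (begin
  - + x * + n - 1ℤ        ≡⟨ identity (+ x) (+ n) ⟩
  - (1ℤ + + x * + n)      ≡⟨ cong (λ t → - (1ℤ + t)) (pos-* x n) ⟨
  - + (1 ℕ.+ x ℕ.* n)     ≡⟨ cong (λ t → - + t) 1+xn≡yp ⟩
  - + (y ℕ.* p)           ≡⟨ cong -_ (pos-* y p) ⟩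
  - (+ y * + p)           ≡⟨ identity′ (+ y) (+ p) ⟩
  - + y * + p             ∎)
  where open ≡-Reasoning
        identity : ∀ u v → - u * v - 1ℤ ≡ - (1ℤ + u * v)
        identity = solve-∀
        identity′ : ∀ u v → - (u * v) ≡ - u * v
        identity′ = solve-∀

inverse-mod-prime : ∀ {p} b → Prime p → ¬ (p ∣ ∣ b ∣) → ∃[ w ] (+ p ∣ℤ w * b - 1ℤ)
inverse-mod-prime b pp p∤b with inverse-mod-primeℕ ∣ b ∣ pp p∤b | +∣i∣≡i⊎+∣i∣≡-i b
... | w , p∣wb-1 | inj₁ ∣b∣≡b  = w , subst (λ t → _ ∣ℤ w * t - 1ℤ) ∣b∣≡b p∣wb-1
... | w , p∣wb-1 | inj₂ ∣b∣≡-b = - w , subst (_ ∣ℤ_) (trans (cong (λ t → w * t - 1ℤ) ∣b∣≡-b) (identity w b)) p∣wb-1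
  where identity : ∀ w b → w * (- b) - 1ℤ ≡ (- w) * b - 1ℤ
        identity = solve-∀

-- If w b ≡ 1 (mod p) then t = a w, resp. 3 a w, satisfies b² (t² + 6) ≡ c N(γ) (w b)² (mod p).
root-candidate : H → ℤ → ℤ
root-candidate (E a _) w = a * w
root-candidate (O a _) w = + 3 * a * w

root-candidate-identity : ∀ γ w → let b = coord₂ γ ; t = root-candidate γ w in ∃[ c ]
  (b * b * (t * t + + 6) ≡ c * (norm γ * ((w * b) * (w * b))) - + 6 * (b * b) * ((w * b - 1ℤ) * (w * b + 1ℤ)))
root-candidate-identity (E a b) w = 1ℤ , identity a b w
  where identity : ∀ a b w → b * b * (a * w * (a * w) + + 6) ≡ 1ℤ * ((a * a + + 6 * (b * b)) * ((w * b) * (w * b))) - + 6 * (b * b) * ((w * b - 1ℤ) * (w * b + 1ℤ))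
        identity = solve-∀
root-candidate-identity (O a b) w = + 3 , identity a b w
  where identity : ∀ a b w → b * b * (+ 3 * a * w * (+ 3 * a * w) + + 6) ≡ + 3 * ((+ 3 * (a * a) + + 2 * (b * b)) * ((w * b) * (w * b))) - + 6 * (b * b) * ((w * b - 1ℤ) * (w * b + 1ℤ))
        identity = solve-∀

√-6-mod-prime : ∀ {p} γ → Prime p → ¬ (p ∣ 6) → Primitive γ → + p ∣ℤ norm γ → ∃[ t ] (+ p ∣ℤ t * t + + 6)
√-6-mod-prime {p} γ pp p∤6 prim p∣N
  with w , p∣wb-1 ← inverse-mod-prime (coord₂ γ) pp (λ p∣b → prim pp (∣norm∧∣coord₂⇒∣ᶜ γ pp p∤6 p∣N (∣ᵤ⇒∣ p∣b)))
  with c , eq ← root-candidate-identity γ w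
  with euclidsLemmaℤ _ _ pp (subst (+ p ∣ℤ_) (sym eq)
         (∣m∣n⇒∣m-n (∣n⇒∣m*n c (∣m⇒∣m*n ((w * coord₂ γ) * (w * coord₂ γ)) p∣N))
                     (∣n⇒∣m*n (+ 6 * (coord₂ γ * coord₂ γ)) (∣m⇒∣m*n (w * coord₂ γ + 1ℤ) p∣wb-1))))
... | inj₁ p∣b² = contradiction (∣norm∧∣coord₂⇒∣ᶜ γ pp p∤6 p∣N (prime∣square⇒∣ _ pp p∣b²)) (prim pp)
... | inj₂ p∣t²+6 = root-candidate γ w , p∣t²+6

residue-root : ∀ {p} t .{{_ : ℕ.NonZero p}} → + p ∣ℤ t * t + + 6 → ∃[ r ] (r < p × + p ∣ℤ + r * + r + + 6)
residue-root {p} t p∣t²+6 = t % + p , n%d<d t (+ p) ,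
  subst (+ p ∣ℤ_) (sym (identity (+ (t % + p)) (t / + p) (+ p)))
    (∣m∣n⇒∣m-n (subst (λ x → + p ∣ℤ x * x + + 6) (a≡a%n+[a/n]*n t (+ p)) p∣t²+6) (∣m⇒∣m*n {+ p} {+ p} _ ∣-refl))
  where identity : ∀ r k p → r * r + + 6 ≡ ((r + k * p) * (r + k * p) + + 6) - p * (+ 2 * r * k + k * k * p)
        identity = solve-∀

reflected-root : ∀ {p r} → r ≤ p → + p ∣ℤ + r * + r + + 6 → + p ∣ℤ + (p ℕ.∸ r) * + (p ℕ.∸ r) + + 6
reflected-root {p} {r} r≤p p∣r²+6 = subst (+ p ∣ℤ_) (sym (identity (+ s) (+ r) (+ p) s+r≡p))
  (∣m∣n⇒∣m+n p∣r²+6 (∣m⇒∣m*n {+ p} {+ p} (+ s - + r) ∣-refl))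
  where
  s = p ℕ.∸ r
  s+r≡p : + s + + r ≡ + p
  s+r≡p = trans (sym (pos-+ s r)) (cong +_ (ℕ.m∸n+n≡m r≤p))
  identity : ∀ s r p → s + r ≡ p → s * s + + 6 ≡ r * r + + 6 + p * (s - r)
  identity s r p refl = lemma s r
    where lemma : ∀ s r → s * s + + 6 ≡ r * r + + 6 + (s + r) * (s - r)
          lemma = solve-∀

halved-root : ∀ {p} t .{{_ : ℕ.NonZero p}} → + p ∣ℤ t * t + + 6 → ∃[ s ] (2 ℕ.* s ≤ p × + p ∣ℤ + s * + s + + 6)
halved-root {p} t p∣t²+6 with r , r<p , p∣r²+6 ← residue-root t p∣t²+6 with 2 ℕ.* r ℕ.≤? p
... | yes 2r≤p = r , 2r≤p , p∣r²+6
... | no  2r≰p = p ℕ.∸ r , 2[p-r]≤p , reflected-root (ℕ.<⇒≤ r<p) p∣r²+6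
  where
  2[p-r]≤p : 2 ℕ.* (p ℕ.∸ r) ≤ p
  2[p-r]≤p = subst₂ _≤_ (sym (ℕ.*-distribˡ-∸ 2 p r)) (ℕ.+-identityʳ p)
    (ℕ.m≤n+o⇒m∸n≤o (2 ℕ.* p) (2 ℕ.* r) (ℕ.+-monoˡ-≤ (p ℕ.+ 0) (ℕ.<⇒≤ (ℕ.≰⇒> 2r≰p))))

IsNorm : ℕ → Set
IsNorm q = ∃[ π ] norm π ≡ + q

pos-square+6 : ∀ s → + s * + s + + 6 ≡ + (s ℕ.* s ℕ.+ 6)
pos-square+6 s = trans (cong (_+ + 6) (sym (pos-* s s))) (sym (pos-+ (s ℕ.* s) 6))

s+√-6-primitive : ∀ s → Primitive (E (+ s) 1ℤ)
s+√-6-primitive s pq (_ , q∣1) = ℕ.<⇒≢ (prime>1 pq) (sym (∣1⇒≡1 (∣⇒∣ᵤ q∣1)))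

-- Fermat's descent starts from s + √-6, whose norm is s² + 6 = m p.
small-cofactor : ∀ {p} s m → Prime p → p ≢ 2 → 2 ℕ.* s ≤ p → s ℕ.* s ℕ.+ 6 ≡ m ℕ.* p → 1 ≤ m × m < p
small-cofactor {p} s m pp p≢2 2s≤p s²+6≡mp = 1≤m , m<p
  where
  open ℕ.≤-Reasoning
  1≤m : 1 ≤ m
  1≤m = ℕ.n≢0⇒n>0 (λ { refl → ℕ.m+1+n≢0 (s ℕ.* s) s²+6≡mp })
  3≤p : 3 ≤ p
  3≤p = ℕ.≤∧≢⇒< (prime>1 pp) (λ 2≡p → p≢2 (sym 2≡p))
  m<p : m < p
  m<p = ℕ.*-cancelʳ-< p m p (ℕ.*-cancelˡ-< 4 (m ℕ.* p) (p ℕ.* p) (begin-strict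
    4 ℕ.* (m ℕ.* p)                 ≡⟨ cong (4 ℕ.*_) s²+6≡mp ⟨
    4 ℕ.* (s ℕ.* s ℕ.+ 6)           ≡⟨ identity s ⟩
    (2 ℕ.* s) ℕ.* (2 ℕ.* s) ℕ.+ 24  ≤⟨ ℕ.+-monoˡ-≤ 24 (ℕ.*-mono-≤ 2s≤p 2s≤p) ⟩
    p ℕ.* p ℕ.+ 24                  <⟨ ℕ.+-monoʳ-< (p ℕ.* p) (ℕ.<-≤-trans (ℕ.m<m+n 24 {3} (s≤s z≤n)) (ℕ.*-monoʳ-≤ 3 (ℕ.*-mono-≤ 3≤p 3≤p))) ⟩
    p ℕ.* p ℕ.+ 3 ℕ.* (p ℕ.* p)     ≡⟨ identity′ p ⟩
    4 ℕ.* (p ℕ.* p)                 ∎))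
    where identity : ∀ s → 4 ℕ.* (s ℕ.* s ℕ.+ 6) ≡ (2 ℕ.* s) ℕ.* (2 ℕ.* s) ℕ.+ 24
          identity = ℕ-Solver.solve-∀
          identity′ : ∀ p → p ℕ.* p ℕ.+ 3 ℕ.* (p ℕ.* p) ≡ 4 ℕ.* (p ℕ.* p)
          identity′ = ℕ-Solver.solve-∀

NormsBelow : ℕ → Set
NormsBelow p = ∀ {q} → q < p → Prime q → ∀ γ → Primitive γ → + q ∣ℤ norm γ → IsNorm q

prime-factor-below : ∀ {p q} → NormsBelow p → q < p → Prime q → ∀ δ → Primitive δ → + q ∣ℤ norm δ →
                  ∃[ ρ ] (norm ρ ≡ + q × ρ ∣ᴴ δ)
prime-factor-below {q = q} below q<p pq δ prim q∣N with q ℕ.≟ 2 | q ℕ.≟ 3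
... | yes refl | _        = √-2 , refl , 2∣norm⇒√-2∣ᴴ δ q∣N
... | no _     | yes refl = √3 , refl , 3∣norm⇒√3∣ᴴ δ q∣N
... | no q≢2   | no q≢3
  with π , Nπ ← below q<p pq δ prim q∣N
  with prime-norm-∣ᴴ π δ pq (prime∤6 pq q≢2 q≢3) Nπ q∣N
... | inj₁ π∣δ = π , Nπ , π∣δ
... | inj₂ π̄∣δ = conj π , trans (norm-conj π) Nπ , π̄∣δ

norm-descent : ∀ {p} → NormsBelow p → ∀ m → 1 ≤ m → m < p → ∀ δ → Primitive δ → norm δ ≡ + (p ℕ.* m) → IsNorm p
norm-descent {p} below = <-rec Goal descend
  where
  Goal : ℕ → Set
  Goal m = 1 ≤ m → m < p → ∀ δ → Primitive δ → norm δ ≡ + (p ℕ.* m) → IsNorm p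
  descend : ∀ m → (∀ {m′} → m′ < m → Goal m′) → Goal m
  descend 1 _ _ _ δ _ Nδ = δ , trans Nδ (cong +_ (ℕ.*-identityʳ p))
  descend m@(suc (suc _)) rec _ m<p δ prim Nδ
    with q , pq , q∣m@(ℕ.divides m′ m≡m′q) ← ∃prime∣ m (s≤s (s≤s z≤n))
    with ρ , Nρ , δ′ , δ≡ρδ′ ← prime-factor-below below (ℕ.≤-<-trans (∣⇒≤ q∣m) m<p) pq δ prim
                                 (subst (+ q ∣ℤ_) (sym Nδ) (∣ᵤ⇒∣ (ℕ.∣n⇒∣m*n p q∣m)))
    = rec m′<m 1≤m′ (ℕ.<-trans m′<m m<p) δ′ (primitive-cofactor ρ δ′ (subst Primitive δ≡ρδ′ prim))
          (norm-cofactor ρ δ′ {{prime⇒nonZero pq}} δ≡ρδ′ Nρ (trans Nδ (cong +_ (identity p m′ q m≡m′q))))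
    where
    identity : ∀ p m′ q {m} → m ≡ m′ ℕ.* q → p ℕ.* m ≡ q ℕ.* (p ℕ.* m′)
    identity p m′ q refl = lemma p m′ q
      where lemma : ∀ p m′ q → p ℕ.* (m′ ℕ.* q) ≡ q ℕ.* (p ℕ.* m′)
            lemma = ℕ-Solver.solve-∀
    1≤m′ : 1 ≤ m′
    1≤m′ = ℕ.n≢0⇒n>0 (λ { refl → ℕ.1+n≢0 m≡m′q })
    m′<m : m′ < m
    m′<m = subst (m′ <_) (sym m≡m′q) (ℕ.m<m*n m′ q {{ℕ.>-nonZero 1≤m′}} (prime>1 pq))

√-6-mod-prime⇒isNorm : ∀ {p} → NormsBelow p → Prime p → p ≢ 2 → ∃[ t ] (+ p ∣ℤ t * t + + 6) → IsNorm p
√-6-mod-prime⇒isNorm {p} below pp p≢2 (t , p∣t²+6)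
  with s , 2s≤p , p∣s²+6 ← halved-root t {{prime⇒nonZero pp}} p∣t²+6
  = descend (∣⇒∣ᵤ (subst (+ p ∣ℤ_) (pos-square+6 s) p∣s²+6))
  where
  descend : p ∣ s ℕ.* s ℕ.+ 6 → IsNorm p
  descend (ℕ.divides m s²+6≡mp) =
    norm-descent below m (proj₁ bounds) (proj₂ bounds) (E (+ s) 1ℤ) (s+√-6-primitive s)
      (trans (pos-square+6 s) (cong +_ (trans s²+6≡mp (ℕ.*-comm m p))))
    where bounds = small-cofactor s m pp p≢2 2s≤p s²+6≡mp

prime∣norm⇒isNorm : ∀ p → Prime p → ∀ γ → Primitive γ → + p ∣ℤ norm γ → IsNorm p
prime∣norm⇒isNorm = <-rec Goal represent
  where
  Goal : ℕ → Set
  Goal p = Prime p → ∀ γ → Primitive γ → + p ∣ℤ norm γ → IsNorm p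
  represent : ∀ p → (∀ {q} → q < p → Goal q) → Goal p
  represent p below pp γ prim p∣N with p ℕ.≟ 2 | p ℕ.≟ 3
  ... | yes refl | _        = √-2 , refl
  ... | no _     | yes refl = √3 , refl
  ... | no p≢2   | no p≢3   =
    √-6-mod-prime⇒isNorm below pp p≢2 (√-6-mod-prime γ pp (prime∤6 pp p≢2 p≢3) prim p∣N)

prime∣norm⇒factor : ∀ {q} → Prime q → ∀ δ → Primitive δ → + q ∣ℤ norm δ → ∃[ ρ ] (norm ρ ≡ + q × ρ ∣ᴴ δ)
prime∣norm⇒factor {q} pq = prime-factor-below {p = suc q} (λ _ pq′ → prime∣norm⇒isNorm _ pq′) (ℕ.n<1+n q) pq

-- Primitive elements whose norm is a perfect power

Sign : ℤ → Set
Sign s = s ≡ 1ℤ ⊎ s ≡ -1ℤ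

Sign-* : ∀ {s t} → Sign s → Sign t → Sign (s * t)
Sign-* (inj₁ refl) (inj₁ refl) = inj₁ refl
Sign-* (inj₁ refl) (inj₂ refl) = inj₂ refl
Sign-* (inj₂ refl) (inj₁ refl) = inj₂ refl
Sign-* (inj₂ refl) (inj₂ refl) = inj₁ refl

Sign-^ : ∀ {s} n → Sign s → Sign (s ℤ.^ n)
Sign-^ zero    _    = inj₁ refl
Sign-^ (suc n) sign = Sign-* sign (Sign-^ n sign)

Sign-*-involutive : ∀ {s} → Sign s → ∀ t → s * (s * t) ≡ t
Sign-*-involutive (inj₁ refl) = solve-∀
Sign-*-involutive (inj₂ refl) = solve-∀

sign-∣∣ : ∀ a → ∃[ s ] (Sign s × a ≡ s * + ∣ a ∣)
sign-∣∣ a with +∣i∣≡i⊎+∣i∣≡-i a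
... | inj₁ ∣a∣≡a  = 1ℤ , inj₁ refl , trans (sym ∣a∣≡a) (sym (*-identityˡ (+ ∣ a ∣)))
... | inj₂ ∣a∣≡-a = -1ℤ , inj₂ refl , trans (sym (neg-involutive a)) (trans (cong -_ (sym ∣a∣≡-a)) (sym (-1*i≡-i (+ ∣ a ∣))))

∣∣≡1⇒sign : ∀ a → ∣ a ∣ ≡ 1 → Sign a
∣∣≡1⇒sign (+ _)      refl = inj₁ refl
∣∣≡1⇒sign ℤ.-[1+ _ ] refl = inj₂ refl

square-∣∣ : ∀ a → a * a ≡ + (∣ a ∣ ℕ.* ∣ a ∣)
square-∣∣ (+ n)      = sym (pos-* n n)
square-∣∣ ℤ.-[1+ n ] = refl

norm-E-∣∣ : ∀ a b → norm (E a b) ≡ + (∣ a ∣ ℕ.* ∣ a ∣ ℕ.+ 6 ℕ.* (∣ b ∣ ℕ.* ∣ b ∣))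
norm-E-∣∣ a b = begin
  a * a + + 6 * (b * b)                                      ≡⟨ cong₂ (λ u v → u + + 6 * v) (square-∣∣ a) (square-∣∣ b) ⟩
  + (∣ a ∣ ℕ.* ∣ a ∣) + + 6 * + (∣ b ∣ ℕ.* ∣ b ∣)            ≡⟨ cong (λ u → + (∣ a ∣ ℕ.* ∣ a ∣) + u) (pos-* 6 (∣ b ∣ ℕ.* ∣ b ∣)) ⟨
  + (∣ a ∣ ℕ.* ∣ a ∣) + + (6 ℕ.* (∣ b ∣ ℕ.* ∣ b ∣))          ≡⟨ pos-+ (∣ a ∣ ℕ.* ∣ a ∣) (6 ℕ.* (∣ b ∣ ℕ.* ∣ b ∣)) ⟨
  + (∣ a ∣ ℕ.* ∣ a ∣ ℕ.+ 6 ℕ.* (∣ b ∣ ℕ.* ∣ b ∣))            ∎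
  where open ≡-Reasoning

norm-O-∣∣ : ∀ a b → norm (O a b) ≡ + (3 ℕ.* (∣ a ∣ ℕ.* ∣ a ∣) ℕ.+ 2 ℕ.* (∣ b ∣ ℕ.* ∣ b ∣))
norm-O-∣∣ a b = begin
  + 3 * (a * a) + + 2 * (b * b)                                    ≡⟨ cong₂ (λ u v → + 3 * u + + 2 * v) (square-∣∣ a) (square-∣∣ b) ⟩
  + 3 * + (∣ a ∣ ℕ.* ∣ a ∣) + + 2 * + (∣ b ∣ ℕ.* ∣ b ∣)            ≡⟨ cong₂ _+_ (pos-* 3 (∣ a ∣ ℕ.* ∣ a ∣)) (pos-* 2 (∣ b ∣ ℕ.* ∣ b ∣)) ⟨
  + (3 ℕ.* (∣ a ∣ ℕ.* ∣ a ∣)) + + (2 ℕ.* (∣ b ∣ ℕ.* ∣ b ∣))        ≡⟨ pos-+ (3 ℕ.* (∣ a ∣ ℕ.* ∣ a ∣)) (2 ℕ.* (∣ b ∣ ℕ.* ∣ b ∣)) ⟨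
  + (3 ℕ.* (∣ a ∣ ℕ.* ∣ a ∣) ℕ.+ 2 ℕ.* (∣ b ∣ ℕ.* ∣ b ∣))          ∎
  where open ≡-Reasoning

x²+6y²≡1⇒ : ∀ x y → x ℕ.* x ℕ.+ 6 ℕ.* (y ℕ.* y) ≡ 1 → x ≡ 1 × y ≡ 0
x²+6y²≡1⇒ x (suc k) eq = contradiction (subst (6 ≤_) eq (ℕ.≤-trans (ℕ.*-monoʳ-≤ 6 (s≤s z≤n)) (ℕ.m≤n+m (6 ℕ.* (suc k ℕ.* suc k)) (x ℕ.* x)))) λ { (s≤s ()) }
x²+6y²≡1⇒ 1 zero refl = refl , refl
x²+6y²≡1⇒ 0 zero ()
x²+6y²≡1⇒ (suc (suc _)) zero ()

3x²+2y²≢1 : ∀ x y → 3 ℕ.* (x ℕ.* x) ℕ.+ 2 ℕ.* (y ℕ.* y) ≢ 1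
3x²+2y²≢1 (suc k) y eq = contradiction (subst (3 ≤_) eq (ℕ.≤-trans (ℕ.*-monoʳ-≤ 3 (s≤s z≤n)) (ℕ.m≤m+n (3 ℕ.* (suc k ℕ.* suc k)) (2 ℕ.* (y ℕ.* y))))) λ { (s≤s ()) }
3x²+2y²≢1 zero (suc k) eq = contradiction (subst (2 ≤_) eq (ℕ.*-monoʳ-≤ 2 (s≤s z≤n))) λ { (s≤s ()) }
3x²+2y²≢1 zero zero ()

norm≡1⇒unit : ∀ γ → norm γ ≡ 1ℤ → ∃[ s ] (Sign s × γ ≡ s ⊙ 𝟙)
norm≡1⇒unit (E a b) N≡1 = unit (x²+6y²≡1⇒ ∣ a ∣ ∣ b ∣ (+-injective (trans (sym (norm-E-∣∣ a b)) N≡1)))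
  where
  unit : ∣ a ∣ ≡ 1 × ∣ b ∣ ≡ 0 → ∃[ s ] (Sign s × E a b ≡ s ⊙ 𝟙)
  unit (∣a∣≡1 , ∣b∣≡0) = a , ∣∣≡1⇒sign a ∣a∣≡1 ,
    cong₂ E (sym (*-identityʳ a)) (trans (∣i∣≡0⇒i≡0 ∣b∣≡0) (sym (*-zeroʳ a)))
norm≡1⇒unit (O a b) N≡1 = contradiction (+-injective (trans (sym (norm-O-∣∣ a b)) N≡1)) (3x²+2y²≢1 ∣ a ∣ ∣ b ∣)

-- A primitive γ divisible by σ, with N(σ) = p ∤ 6, is not divisible by σ̄ (σσ̄ = p), so the
-- whole p-part of N(γ) comes from powers of σ.
power-∣ᴴ : ∀ {p} σ → Prime p → ¬ (p ∣ 6) → norm σ ≡ + p → ∀ k {Y} γ → Primitive γ → σ ∣ᴴ γ →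
           norm γ ≡ + (p ℕ.^ suc k ℕ.* Y) → ∃[ δ ] (γ ≡ σ ^ᴴ suc k ⊗ δ × norm δ ≡ + Y)
power-∣ᴴ {p} σ pp p∤6 Nσ zero {Y} γ prim (δ , γ≡σδ) Nγ =
  δ , trans γ≡σδ (cong (_⊗ δ) (sym (⊗-identityʳ σ))) ,
  norm-cofactor σ δ {{prime⇒nonZero pp}} γ≡σδ Nσ (trans Nγ (cong (λ t → + (t ℕ.* Y)) (ℕ.*-identityʳ p)))
power-∣ᴴ {p} σ pp p∤6 Nσ (suc k) {Y} γ prim (δ , γ≡σδ) Nγ = peel (prime-norm-∣ᴴ σ δ pp p∤6 Nσ p∣Nδ)
  where
  Nδ : norm δ ≡ + (p ℕ.^ suc k ℕ.* Y)
  Nδ = norm-cofactor σ δ {{prime⇒nonZero pp}} γ≡σδ Nσ (trans Nγ (cong +_ (ℕ.*-assoc p (p ℕ.^ suc k) Y)))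
  p∣Nδ : + p ∣ℤ norm δ
  p∣Nδ = subst (+ p ∣ℤ_) (sym Nδ) (∣ᵤ⇒∣ (ℕ.∣m⇒∣m*n Y (ℕ.m∣m*n (p ℕ.^ k))))
  primδ : Primitive δ
  primδ = primitive-cofactor σ δ (subst Primitive γ≡σδ prim)
  peel : σ ∣ᴴ δ ⊎ conj σ ∣ᴴ δ → ∃[ δ′ ] (γ ≡ σ ^ᴴ suc (suc k) ⊗ δ′ × norm δ′ ≡ + Y)
  peel (inj₁ σ∣δ) = δ′ , γ≡σ^δ′ , Nδ′
    where
    open ≡-Reasoning
    rest = power-∣ᴴ σ pp p∤6 Nσ k δ primδ σ∣δ Nδ
    δ′ = proj₁ rest
    Nδ′ = proj₂ (proj₂ rest)
    γ≡σ^δ′ : γ ≡ σ ^ᴴ suc (suc k) ⊗ δ′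
    γ≡σ^δ′ = begin
      γ                          ≡⟨ γ≡σδ ⟩
      σ ⊗ δ                      ≡⟨ cong (σ ⊗_) (proj₁ (proj₂ rest)) ⟩
      σ ⊗ (σ ^ᴴ suc k ⊗ δ′)      ≡⟨ ⊗-assoc σ _ δ′ ⟨
      σ ^ᴴ suc (suc k) ⊗ δ′      ∎
  peel (inj₂ (δ′ , δ≡σ̄δ′)) = contradiction p∣γ (prim pp)
    where
    p∣γ : + p ∣ᶜ γ
    p∣γ = subst (+ p ∣ᶜ_) (sym (trans γ≡σδ (trans (cong (σ ⊗_) δ≡σ̄δ′)
                  (trans (⊗-conj-⊗ σ δ′) (cong (_⊙ δ′) Nσ))))) (∣ᶜ-⊙ (+ p) δ′)

*-^-distrib : ∀ m n k → (m ℕ.* n) ℕ.^ k ≡ m ℕ.^ k ℕ.* n ℕ.^ k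
*-^-distrib m n zero    = refl
*-^-distrib m n (suc k) = trans (cong (m ℕ.* n ℕ.*_) (*-^-distrib m n k)) (identity m n (m ℕ.^ k) (n ℕ.^ k))
  where identity : ∀ m n x y → m ℕ.* n ℕ.* (x ℕ.* y) ≡ m ℕ.* x ℕ.* (n ℕ.* y)
        identity = ℕ-Solver.solve-∀

IsPower : ℕ → ℕ → H → Set
IsPower n y γ = ∃[ s ] ∃[ β ] (Sign s × norm β ≡ + y × γ ≡ s ⊙ β ^ᴴ n)

prime-power-factor : ∀ {p} n {y} γ → Prime p → ¬ (p ∣ 6) → Primitive γ → norm γ ≡ + ((y ℕ.* p) ℕ.^ suc n) →
  ∃[ σ ] ∃[ δ ] (norm σ ≡ + p × Primitive δ × norm δ ≡ + (y ℕ.^ suc n) × γ ≡ σ ^ᴴ suc n ⊗ δ)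
prime-power-factor {p} n {y} γ pp p∤6 prim Nγ = σ , δ , Nσ , primδ , proj₂ (proj₂ peeled) , γ≡σⁿδ
  where
  factor = prime∣norm⇒factor pp γ prim (subst (+ p ∣ℤ_) (sym Nγ) (∣ᵤ⇒∣ (ℕ.∣m⇒∣m*n ((y ℕ.* p) ℕ.^ n) (ℕ.n∣m*n y))))
  σ = proj₁ factor
  Nσ = proj₁ (proj₂ factor)
  peeled = power-∣ᴴ σ pp p∤6 Nσ n γ prim (proj₂ (proj₂ factor))
             (trans Nγ (cong +_ (trans (*-^-distrib y p (suc n)) (ℕ.*-comm (y ℕ.^ suc n) (p ℕ.^ suc n)))))
  δ = proj₁ peeled
  γ≡σⁿδ = proj₁ (proj₂ peeled)
  primδ : Primitive δ
  primδ = primitive-cofactor (σ ^ᴴ suc n) δ (subst Primitive γ≡σⁿδ prim)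

IsPower-⊗ : ∀ {p y} n σ δ → norm σ ≡ + p → IsPower n y δ → IsPower n (p ℕ.* y) (σ ^ᴴ n ⊗ δ)
IsPower-⊗ {p} {y} n σ δ Nσ (s , β , sign , Nβ , δ≡sβⁿ) =
  s , σ ⊗ β , sign , trans (norm-⊗ σ β) (trans (cong₂ _*_ Nσ Nβ) (sym (pos-* p y))) , (begin
    σ ^ᴴ n ⊗ δ                ≡⟨ cong (σ ^ᴴ n ⊗_) δ≡sβⁿ ⟩
    σ ^ᴴ n ⊗ s ⊙ β ^ᴴ n       ≡⟨ ⊙-⊗ʳ s (σ ^ᴴ n) (β ^ᴴ n) ⟩
    s ⊙ (σ ^ᴴ n ⊗ β ^ᴴ n)     ≡⟨ cong (s ⊙_) (^ᴴ-distrib-⊗ σ β n) ⟨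
    s ⊙ (σ ⊗ β) ^ᴴ n          ∎)
  where open ≡-Reasoning

primitive-norm-power : ∀ n y → ¬ (2 ∣ y) → ¬ (3 ∣ y) → ∀ γ → Primitive γ → norm γ ≡ + (y ℕ.^ suc n) → IsPower (suc n) y γ
primitive-norm-power n = <-rec Goal descend
  where
  Goal : ℕ → Set
  Goal y = ¬ (2 ∣ y) → ¬ (3 ∣ y) → ∀ γ → Primitive γ → norm γ ≡ + (y ℕ.^ suc n) → IsPower (suc n) y γ
  descend : ∀ y → (∀ {y′} → y′ < y → Goal y′) → Goal y
  descend 0 _ 2∤y _ _ _ _ = contradiction (ℕ.divides 0 refl) 2∤y
  descend 1 _ _ _ γ _ Nγ with norm≡1⇒unit γ (trans Nγ (cong +_ (ℕ.^-zeroˡ (suc n))))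
  ... | s , sign , γ≡s𝟙 = s , 𝟙 , sign , refl , trans γ≡s𝟙 (cong (s ⊙_) (sym (𝟙-^ᴴ (suc n))))
  descend y@(suc (suc _)) rec 2∤y 3∤y γ prim Nγ
    with p , pp , p∣y@(ℕ.divides y′ y≡y′p) ← ∃prime∣ y (s≤s (s≤s z≤n))
    = case prime-power-factor n {y′} γ pp p∤6 prim (trans Nγ (cong (λ t → + (t ℕ.^ suc n)) y≡y′p)) of λ
        { (σ , δ , Nσ , primδ , Nδ , γ≡σⁿδ) →
          subst₂ (IsPower (suc n)) (trans (ℕ.*-comm p y′) (sym y≡y′p)) (sym γ≡σⁿδ)
            (IsPower-⊗ (suc n) σ δ Nσ (rec y′<y (λ 2∣y′ → 2∤y (∣-trans 2∣y′ y′∣y)) (λ 3∣y′ → 3∤y (∣-trans 3∣y′ y′∣y)) δ primδ Nδ)) }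
    where
    y′∣y : y′ ∣ y
    y′∣y = ℕ.divides p (trans y≡y′p (ℕ.*-comm y′ p))
    y′<y : y′ < y
    y′<y = subst (y′ <_) (sym y≡y′p) (ℕ.m<m*n y′ p {{ℕ.>-nonZero (ℕ.n≢0⇒n>0 λ { refl → ℕ.1+n≢0 y≡y′p })}} (prime>1 pp))
    p∤6 : ¬ (p ∣ 6)
    p∤6 = prime∤6 pp (λ { refl → 2∤y p∣y }) (λ { refl → 3∤y p∣y })

-- Application to x√3 + d√-2

emb : H → ℤ√3√-2
emb (E a b) = ⟨ a , 0ℤ , 0ℤ , b ⟩
emb (O a b) = a √3+ b √-2

⟨⟩-cong : ∀ {a b c e a′ b′ c′ e′} → a ≡ a′ → b ≡ b′ → c ≡ c′ → e ≡ e′ → ⟨ a , b , c , e ⟩ ≡ ⟨ a′ , b′ , c′ , e′ ⟩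
⟨⟩-cong refl refl refl refl = refl

emb-⊗ : ∀ x y → emb (x ⊗ y) ≡ emb x · emb y
emb-⊗ (E a b) (E c d) = ⟨⟩-cong (i₁ a b c d) (i₂ a b c d) (i₃ a b c d) (i₄ a b c d)
  where
  i₁ : ∀ a b c d → a * c - + 6 * (b * d) ≡ a * c + + 3 * (0ℤ * 0ℤ) - + 2 * (0ℤ * 0ℤ) - + 6 * (b * d)
  i₁ = solve-∀
  i₂ : ∀ a b c d → 0ℤ ≡ a * 0ℤ + 0ℤ * c - + 2 * (0ℤ * d) - + 2 * (b * 0ℤ)
  i₂ = solve-∀
  i₃ : ∀ a b c d → 0ℤ ≡ a * 0ℤ + 0ℤ * c + + 3 * (0ℤ * d) + + 3 * (b * 0ℤ)
  i₃ = solve-∀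
  i₄ : ∀ a b c d → a * d + b * c ≡ a * d + b * c + 0ℤ * 0ℤ + 0ℤ * 0ℤ
  i₄ = solve-∀
emb-⊗ (E a b) (O c d) = ⟨⟩-cong (i₁ a b c d) (i₂ a b c d) (i₃ a b c d) (i₄ a b c d)
  where
  i₁ : ∀ a b c d → 0ℤ ≡ a * 0ℤ + + 3 * (0ℤ * c) - + 2 * (0ℤ * d) - + 6 * (b * 0ℤ)
  i₁ = solve-∀
  i₂ : ∀ a b c d → a * c - + 2 * (b * d) ≡ a * c + 0ℤ * 0ℤ - + 2 * (0ℤ * 0ℤ) - + 2 * (b * d)
  i₂ = solve-∀
  i₃ : ∀ a b c d → a * d + + 3 * (b * c) ≡ a * d + 0ℤ * 0ℤ + + 3 * (0ℤ * 0ℤ) + + 3 * (b * c)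
  i₃ = solve-∀
  i₄ : ∀ a b c d → 0ℤ ≡ a * 0ℤ + b * 0ℤ + 0ℤ * d + 0ℤ * c
  i₄ = solve-∀
emb-⊗ (O a b) (E c d) = ⟨⟩-cong (i₁ a b c d) (i₂ a b c d) (i₃ a b c d) (i₄ a b c d)
  where
  i₁ : ∀ a b c d → 0ℤ ≡ 0ℤ * c + + 3 * (a * 0ℤ) - + 2 * (b * 0ℤ) - + 6 * (0ℤ * d)
  i₁ = solve-∀
  i₂ : ∀ a b c d → c * a - + 2 * (d * b) ≡ 0ℤ * 0ℤ + a * c - + 2 * (b * d) - + 2 * (0ℤ * 0ℤ)
  i₂ = solve-∀
  i₃ : ∀ a b c d → c * b + + 3 * (d * a) ≡ 0ℤ * 0ℤ + b * c + + 3 * (a * d) + + 3 * (0ℤ * 0ℤ)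
  i₃ = solve-∀
  i₄ : ∀ a b c d → 0ℤ ≡ 0ℤ * d + 0ℤ * c + a * 0ℤ + b * 0ℤ
  i₄ = solve-∀
emb-⊗ (O a b) (O c d) = ⟨⟩-cong (i₁ a b c d) (i₂ a b c d) (i₃ a b c d) (i₄ a b c d)
  where
  i₁ : ∀ a b c d → + 3 * (a * c) - + 2 * (b * d) ≡ 0ℤ * 0ℤ + + 3 * (a * c) - + 2 * (b * d) - + 6 * (0ℤ * 0ℤ)
  i₁ = solve-∀
  i₂ : ∀ a b c d → 0ℤ ≡ 0ℤ * c + a * 0ℤ - + 2 * (b * 0ℤ) - + 2 * (0ℤ * d)
  i₂ = solve-∀
  i₃ : ∀ a b c d → 0ℤ ≡ 0ℤ * d + b * 0ℤ + + 3 * (a * 0ℤ) + + 3 * (0ℤ * c)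
  i₃ = solve-∀
  i₄ : ∀ a b c d → a * d + b * c ≡ 0ℤ * 0ℤ + 0ℤ * 0ℤ + a * d + b * c
  i₄ = solve-∀

emb-^ᴴ : ∀ x n → emb (x ^ᴴ n) ≡ emb x ^ n
emb-^ᴴ x zero    = refl
emb-^ᴴ x (suc n) = trans (emb-⊗ x (x ^ᴴ n)) (cong (emb x ·_) (emb-^ᴴ x n))

emb-⊙ : ∀ k x → emb (k ⊙ x) ≡ k • emb x
emb-⊙ k (E a b) = ⟨⟩-cong refl (sym (*-zeroʳ k)) (sym (*-zeroʳ k)) refl
emb-⊙ k (O a b) = ⟨⟩-cong (sym (*-zeroʳ k)) refl refl (sym (*-zeroʳ k))

emb-⊙-^ᴴ-⊙ : ∀ s t β n → emb (s ⊙ (t ⊙ β) ^ᴴ n) ≡ (s * t ℤ.^ n) • (emb β ^ n)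
emb-⊙-^ᴴ-⊙ s t β n = begin
  emb (s ⊙ (t ⊙ β) ^ᴴ n)          ≡⟨ cong (λ x → emb (s ⊙ x)) (^ᴴ-⊙ t β n) ⟩
  emb (s ⊙ (t ℤ.^ n) ⊙ β ^ᴴ n)    ≡⟨ cong emb (⊙-⊙ s (t ℤ.^ n) (β ^ᴴ n)) ⟩
  emb ((s * t ℤ.^ n) ⊙ β ^ᴴ n)    ≡⟨ emb-⊙ (s * t ℤ.^ n) (β ^ᴴ n) ⟩
  (s * t ℤ.^ n) • emb (β ^ᴴ n)    ≡⟨ cong ((s * t ℤ.^ n) •_) (emb-^ᴴ β n) ⟩
  (s * t ℤ.^ n) • (emb β ^ n)     ∎
  where open ≡-Reasoning

E-^ᴴ : ∀ a b n → ∃[ c ] ∃[ e ] E a b ^ᴴ n ≡ E c e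
E-^ᴴ a b zero    = 1ℤ , 0ℤ , refl
E-^ᴴ a b (suc n) with c , e , eq ← E-^ᴴ a b n = _ , _ , cong (E a b ⊗_) eq

O-^ᴴ : ∀ a b n → ((∃[ k ] n ≡ 2 ℕ.* k) × ∃[ c ] ∃[ e ] O a b ^ᴴ n ≡ E c e) ⊎ (Odd n × ∃[ c ] ∃[ e ] O a b ^ᴴ n ≡ O c e)
O-^ᴴ a b zero = inj₁ ((0 , refl) , 1ℤ , 0ℤ , refl)
O-^ᴴ a b (suc n) with O-^ᴴ a b n
... | inj₁ ((k , n≡2k) , c , e , eq) = inj₂ ((k , cong suc n≡2k) , _ , _ , cong (O a b ⊗_) eq)
... | inj₂ ((k , n≡1+2k) , c , e , eq) = inj₁ ((suc k , trans (cong suc n≡1+2k) (sym (ℕ.+-suc (suc k) (k ℕ.+ 0)))) , _ , _ , cong (O a b ⊗_) eq)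

O≡⊙^ᴴ⇒odd : ∀ {u v} s β n → O u v ≡ s ⊙ β ^ᴴ n → Odd n × ∃[ a ] ∃[ b ] β ≡ O a b
O≡⊙^ᴴ⇒odd s (E a b) n eq with E-^ᴴ a b n
... | c , e , βⁿ≡E = contradiction (trans eq (cong (s ⊙_) βⁿ≡E)) λ ()
O≡⊙^ᴴ⇒odd s (O a b) n eq with O-^ᴴ a b n
... | inj₁ (_ , c , e , βⁿ≡E) = contradiction (trans eq (cong (s ⊙_) βⁿ≡E)) λ ()
... | inj₂ (odd , _) = odd , a , b , refl

O-sign-form : ∀ a b → ∃[ sa ] ∃[ λ₂ ] (Sign sa × Sign λ₂ × O a b ≡ sa ⊙ O (+ ∣ a ∣) (λ₂ * + ∣ b ∣))
O-sign-form a b with sa , sign-a , a≡ ← sign-∣∣ a | sb , sign-b , b≡ ← sign-∣∣ b =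
  sa , sa * sb , sign-a , Sign-* sign-a sign-b ,
  cong₂ O a≡ (trans b≡ (trans (sym (Sign-*-involutive sign-a (sb * + ∣ b ∣))) (cong (sa *_) (sym (*-assoc sa sb _)))))

O-norm-coprime-to-6 : ∀ a b {y} → norm (O a b) ≡ + y → ¬ (2 ∣ y) → ¬ (3 ∣ y) →
                      1 ≤ ∣ a ∣ × 1 ≤ ∣ b ∣ × y ≡ 3 ℕ.* ∣ a ∣ ℕ.^ 2 ℕ.+ 2 ℕ.* ∣ b ∣ ℕ.^ 2
O-norm-coprime-to-6 a b {y} Nβ 2∤y 3∤y = 1≤X , 1≤Y ,
  trans y≡3X²+2Y² (cong₂ (λ u v → 3 ℕ.* (X ℕ.* u) ℕ.+ 2 ℕ.* (Y ℕ.* v)) (sym (ℕ.*-identityʳ X)) (sym (ℕ.*-identityʳ Y)))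
  where
  X = ∣ a ∣
  Y = ∣ b ∣
  y≡3X²+2Y² : y ≡ 3 ℕ.* (X ℕ.* X) ℕ.+ 2 ℕ.* (Y ℕ.* Y)
  y≡3X²+2Y² = +-injective (trans (sym Nβ) (norm-O-∣∣ a b))
  1≤X : 1 ≤ X
  1≤X = ℕ.n≢0⇒n>0 λ X≡0 → 2∤y (ℕ.divides (Y ℕ.* Y)
    (trans y≡3X²+2Y² (trans (cong (λ t → 3 ℕ.* (t ℕ.* t) ℕ.+ 2 ℕ.* (Y ℕ.* Y)) X≡0) (ℕ.*-comm 2 (Y ℕ.* Y)))))
  1≤Y : 1 ≤ Y
  1≤Y = ℕ.n≢0⇒n>0 λ Y≡0 → 3∤y (ℕ.divides (X ℕ.* X)
    (trans y≡3X²+2Y² (trans (cong (λ t → 3 ℕ.* (X ℕ.* X) ℕ.+ 2 ℕ.* (t ℕ.* t)) Y≡0)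
      (trans (ℕ.+-identityʳ (3 ℕ.* (X ℕ.* X))) (ℕ.*-comm 3 (X ℕ.* X))))))

coprime⇒primitive : ∀ {x y n} d → gcd x y ≡ 1 → norm (O (+ x) (+ d)) ≡ + (y ℕ.^ n) → Primitive (O (+ x) (+ d))
coprime⇒primitive {x} {y} {n} d gcd≡1 Nγ {q} pq q∣γ = ℕ.<⇒≢ (prime>1 pq) (sym (∣1⇒≡1 (subst (q ∣_) gcd≡1 q∣gcd)))
  where
  q∣gcd : q ∣ gcd x y
  q∣gcd = gcd-greatest (∣⇒∣ᵤ (proj₁ q∣γ)) (prime∣^⇒∣ y n pq (∣⇒∣ᵤ (subst (+ q ∣ℤ_) Nγ (∣ᶜ⇒∣norm (O (+ x) (+ d)) q∣γ))))

norm-power-coprime-to-6 : ∀ γ {y} m → Primitive γ → norm γ ≡ + (y ℕ.^ suc (suc m)) → ¬ (2 ∣ y) × ¬ (3 ∣ y)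
norm-power-coprime-to-6 γ {y} m prim Nγ = (λ 2∣y → primitive⇒4∤norm γ prim (square∣norm 2∣y)) , (λ 3∣y → primitive⇒9∤norm γ prim (square∣norm 3∣y))
  where
  square∣norm : ∀ {p} → p ∣ y → + p * + p ∣ℤ norm γ
  square∣norm {p} p∣y = subst (_ ∣ℤ_) (sym Nγ)
    (∣ᵤ⇒∣ (subst (ℕ._∣ y ℕ.^ suc (suc m)) (sym (abs-* (+ p) (+ p))) (ℕ.*-pres-∣ p∣y (ℕ.∣m⇒∣m*n (y ℕ.^ m) p∣y))))

three-squares : ∀ x d → (x - d) ℤ.^ 2 + x ℤ.^ 2 + (x + d) ℤ.^ 2 ≡ norm (O x d)
three-squares x d = identity x d
  where identity : ∀ x d → (x - d) * ((x - d) * 1ℤ) + x * (x * 1ℤ) + (x + d) * ((x + d) * 1ℤ) ≡ + 3 * (x * x) + + 2 * (d * d)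
        identity = solve-∀

pos-^ : ∀ y n → (+ y) ℤ.^ n ≡ + (y ℕ.^ n)
pos-^ y zero    = refl
pos-^ y (suc n) = trans (cong (+ y *_) (pos-^ y n)) (sym (pos-* y (y ℕ.^ n)))

Representation : ℕ → ℕ → ℕ → ℕ → Set
Representation n x d y = ∃[ λ₁ ] ∃[ λ₂ ] ∃[ X₁ ] ∃[ Y₁ ]
  (Sign λ₁ × Sign λ₂ × 1 ≤ X₁ × 1 ≤ Y₁ × gcd X₁ Y₁ ≡ 1 ×
   ((+ x) √3+ (+ d) √-2 ≡ λ₁ • (((+ X₁) √3+ (λ₂ * + Y₁) √-2) ^ n)) ×
   y ≡ 3 ℕ.* X₁ ℕ.^ 2 ℕ.+ 2 ℕ.* Y₁ ℕ.^ 2)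

power⇒representation : ∀ {x d y} n → ¬ (2 ∣ y) → ¬ (3 ∣ y) → Primitive (O (+ x) (+ d)) →
                       IsPower n y (O (+ x) (+ d)) → Odd n × Representation n x d y
power⇒representation {x} {d} {y} n 2∤y 3∤y prim (s , β , sign , Nβ , γ≡sβⁿ)
  with O≡⊙^ᴴ⇒odd s β n γ≡sβⁿ
... | odd@(k , n≡1+2k) , a , b , refl
  with sa , λ₂ , sign-a , sign-λ₂ , β≡ ← O-sign-form a b
  with 1≤X , 1≤Y , y≡ ← O-norm-coprime-to-6 a b Nβ 2∤y 3∤y
  = odd , s * sa ℤ.^ n , λ₂ , ∣ a ∣ , ∣ b ∣ , Sign-* sign (Sign-^ n sign-a) , sign-λ₂ , 1≤X , 1≤Y ,
    primitive-coprime (O a b) primβ 1≤X ,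
    trans (cong emb (trans γ≡sβⁿ (cong (λ β → s ⊙ β ^ᴴ n) β≡))) (emb-⊙-^ᴴ-⊙ s sa (O (+ ∣ a ∣) (λ₂ * + ∣ b ∣)) n) ,
    y≡
  where
  primβ : Primitive (O a b)
  primβ = primitive-base s (O a b) (2 ℕ.* k) (subst Primitive (trans γ≡sβⁿ (cong (λ t → s ⊙ O a b ^ᴴ t) n≡1+2k)) prim)

lemma2p2 : (d n x y : ℕ) → d ≥ 1 → n ≥ 2 → x ≥ 1 → y ≥ 1 → gcd x y ≡ 1 →
    ((+ x - + d) ℤ.^ 2 + (+ x) ℤ.^ 2 + (+ x + + d) ℤ.^ 2 ≡ (+ y) ℤ.^ n) →
    Odd n ×
    ∃[ λ₁ ] ∃[ λ₂ ] ∃[ X₁ ] ∃[ Y₁ ]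
      ((λ₁ ≡ 1ℤ ⊎ λ₁ ≡ -1ℤ) × (λ₂ ≡ 1ℤ ⊎ λ₂ ≡ -1ℤ) ×
       1 ≤ X₁ × 1 ≤ Y₁ × gcd X₁ Y₁ ≡ 1 ×
       ((+ x) √3+ (+ d) √-2 ≡ λ₁ • (((+ X₁) √3+ (λ₂ * + Y₁) √-2) ^ n)) ×
       y ≡ 3 ℕ.* X₁ ℕ.^ 2 ℕ.+ 2 ℕ.* Y₁ ℕ.^ 2)
lemma2p2 d n@(suc (suc m)) x y _ (s≤s (s≤s _)) _ _ gcd≡1 sum≡yⁿ =
  power⇒representation n 2∤y 3∤y prim (primitive-norm-power (suc m) y 2∤y 3∤y γ prim Nγ)
  where
  γ = O (+ x) (+ d)
  Nγ : norm γ ≡ + (y ℕ.^ n)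
  Nγ = trans (sym (three-squares (+ x) (+ d))) (trans sum≡yⁿ (pos-^ y n))
  prim : Primitive γ
  prim = coprime⇒primitive {n = n} d gcd≡1 Nγ
  2∤y : ¬ (2 ∣ y)
  2∤y = proj₁ (norm-power-coprime-to-6 γ m prim Nγ)
  3∤y : ¬ (3 ∣ y)
  3∤y = proj₂ (norm-power-coprime-to-6 γ m prim Nγ)
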